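{- Let $\mathbf{G}^{\mathbf{I}}$ be a GTIR such that, for every global type $G$ in the set of components $\mathcal{C}(\mathbf{G}^{\mathbf{I}})$, the communicating system $(G\!\upharpoonright\!\mathtt{p})_{\mathtt{p}\in\mathbf{P}(G)}$ is safe. Then $[\![\mathbf{G}^{\mathbf{I}}]\!]$ is safe.
   Context: A CFSM over finite sets $\mathbf{P}$ of roles and $\mathbb{A}$ of messages is $M=(Q,q_0,\mathbb{A},\delta)$ with $Q$ finite, $q_0\in Q$, $\delta\subseteq Q\times Act\times Q$, $Act=C_\mathbf{P}\times\{!,?\}\times\mathbb{A}$, $C_\mathbf{P}=\{\mathtt{p}\mathtt{q}\mid \mathtt{p},\mathtt{q}\in\mathbf{P},\mathtt{p}\neq\mathtt{q}\}$. Label $\mathtt{s}\mathtt{r}!a$: $\mathtt{s}$ sends $a$ on channel $\mathtt{s}\mathtt{r}$; $\mathtt{s}\mathtt{r}?a$: $\mathtt{r}$ consumes $a$ from $\mathtt{s}\mathtt{r}$. $\mathcal{L}(M)$ is the language of $M$ with all states accepting. A state is final if it has no outgoing transition, sending (resp. receiving) if all outgoing transitions are sending (resp. receiving) actions, mixed otherwise. $M$ is ?-deterministic if for every state $q$, $(q,\mathtt{r}\mathtt{s}?a,q'),(q,\mathtt{p}\mathtt{q}?a,q'')\in\delta$ imply $q'=q''$; !-deterministic analogously; ?!-deterministic if both. A communicating system is $S=(M_\mathtt{p})_{\mathtt{p}\in\mathbf{P}}$, $M_\mathtt{p}=(Q_\mathtt{p},q_{0\mathtt{p}},\mathbb{A},\delta_\mathtt{p})$;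 configurations $(\vec q,\vec w)$ with a local state per role and a FIFO word $w_{\mathtt{p}\mathtt{q}}\in\mathbb{A}^*$ per channel; initial: initial states, empty channels; a send $\mathtt{s}\mathtt{r}!a$ by $\mathtt{s}$ appends $a$ to $w_{\mathtt{s}\mathtt{r}}$, a receive $\mathtt{s}\mathtt{r}?a$ by $\mathtt{r}$ removes $a$ from the front of $w_{\mathtt{s}\mathtt{r}}$, all else unchanged. $RS(S)$: reachable configurations. Deadlock configuration: all channels empty and every local state receiving. Orphan-message configuration: every local state final and some channel nonempty. Unspecified reception configuration: some role $\mathtt{r}$ has $q_\mathtt{r}$ receiving and, for every $\mathtt{s}$ and every $(q_\mathtt{r},\mathtt{s}\mathtt{r}?a,q')\in\delta_\mathtt{r}$, $|w_{\mathtt{s}\mathtt{r}}|>0$ and $w_{\mathtt{s}\mathtt{r}}\notin a\mathbb{A}^*$. $S$ is safe if no configuration in $RS(S)$ is of any of these three kinds. $M\leftrightarrow M'$ (compatible) if $\mathcal{L}(M)^{\not C}=\overline{\mathcal{L}(M')^{\not C}}$ (channel names erased, $!$ and $?$ swapped), neither has mixed states, both ?!-deterministic. Gateway $\mathrm{gw}(M_{\tt H},{\tt K})$ for $M_{\tt H}=(Q,q_0,\mathbb{A},\delta)$: states $Q\cup\widehat Q$, one fresh state $q^t$ per $t=(q,l,q')\in\delta$; transitions: for $t=(q,{\tt H}\mathtt{s}!a,q')\in\delta$, $(q,{\tt K}{\tt H}?a,q^t),(q^t,{\tt H}\mathtt{s}!a,q')$; for $t=(q,\mathtt{s}{\tt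 H}?a,q')\in\delta$, $(q,\mathtt{s}{\tt H}?a,q^t),(q^t,{\tt H}{\tt K}!a,q')$; initial state $q_0$. Composition of systems $S_1=(M^1_\mathtt{p})_{\mathtt{p}\in\mathbf{P}_1}$, $S_2=(M^2_\mathtt{p})_{\mathtt{p}\in\mathbf{P}_2}$ with $\mathbf{P}_1\cap\mathbf{P}_2=\emptyset$, ${\tt H}\in\mathbf{P}_1$, ${\tt K}\in\mathbf{P}_2$, $M^1_{\tt H}\leftrightarrow M^2_{\tt K}$: $S_1\bowtie_{{\tt H},{\tt K}}S_2=(M_\mathtt{p})_{\mathtt{p}\in\mathbf{P}_1\cup\mathbf{P}_2}$ with $M_{\tt H}=\mathrm{gw}(M^1_{\tt H},{\tt K})$, $M_{\tt K}=\mathrm{gw}(M^2_{\tt K},{\tt H})$, $M_\mathtt{p}=M^i_\mathtt{p}$ otherwise. GTIRs: fix a global type formalism in which each global type $G$ has a finite role set $\mathbf{P}(G)$, a finite message set $\mathbb{A}(G)$, and for each $\mathtt{p}\in\mathbf{P}(G)$ a projection $G\!\upharpoonright\!\mathtt{p}$, a CFSM over $\mathbf{P}(G),\mathbb{A}(G)$. GTIRs $\mathbf{G}^{\mathbf{I}}$, their role sets, components $\mathcal{C}(\cdot)$, projections and semantics $[\![\cdot]\!]$ are defined inductively: (base) $G^{\mathbf{I}}$ with $\mathbf{I}\subseteq\mathbf{P}(G)$ is a GTIR if no projection $G\!\upharpoonright\!\mathtt{p}$ has a transition labelled ${\tt I}{\tt J}!a$ or ${\tt I}{\tt J}?a$ with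 ${\tt I},{\tt J}\in\mathbf{I}$; roles $\mathbf{P}(G)$, $\mathcal{C}(G^{\mathbf{I}})=\{G\}$, $[\![G^{\mathbf{I}}]\!]=(G\!\upharpoonright\!\mathtt{p})_{\mathtt{p}\in\mathbf{P}(G)}$. (composite) If $\mathbf{G}_1^{\mathbf{H}},\mathbf{G}_2^{\mathbf{K}}$ are GTIRs with disjoint role sets, ${\tt H}\in\mathbf{H}$, ${\tt K}\in\mathbf{K}$, $\mathbf{I}=(\mathbf{H}\cup\mathbf{K})\setminus\{{\tt H},{\tt K}\}$, and $\mathbf{G}_1^{\mathbf{H}}\!\upharpoonright\!{\tt H}\leftrightarrow\mathbf{G}_2^{\mathbf{K}}\!\upharpoonright\!{\tt K}$ (where the projection of a GTIR onto $\mathtt{p}$ is $G\!\upharpoonright\!\mathtt{p}$ for the component $G$ with $\mathtt{p}\in\mathbf{P}(G)$), then $(\mathbf{G}_1^{\mathbf{H}}\bowtie_{{\tt H},{\tt K}}\mathbf{G}_2^{\mathbf{K}})^{\mathbf{I}}$ is a GTIR with roles and components the unions of those of $\mathbf{G}_1^{\mathbf{H}},\mathbf{G}_2^{\mathbf{K}}$ and semantics $[\![\mathbf{G}_1^{\mathbf{H}}]\!]\bowtie_{{\tt H},{\tt K}}[\![\mathbf{G}_2^{\mathbf{K}}]\!]$. -}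

module Defs where

open import Data.Nat using (ℕ; _+_)
open import Data.Fin using (Fin; _↑ˡ_; _↑ʳ_)
open import Data.List using (List; []; _∷_; _++_; length; map; concat; tabulate; lookup; filter)
open import Data.List.Membership.Propositional using (_∈_)
open import Data.List.Relation.Binary.Subset.Propositional using (_⊆_)
import Data.List.Membership.DecPropositional as DecMem
open import Data.Product using (Σ; ∃; ∃₂; _×_; _,_)
open import Data.Empty using (⊥)
open import Relation.Nullary using (¬_; yes; no)
open import Relation.Nullary.Decidable using (¬?; _×-dec_)
open import Relation.Binary.PropositionalEquality using (_≡_; _≢_)
open import Relation.Binary.Definitions using (DecidableEquality)
open import Relation.Binary.Construct.Closure.ReflexiveTransitive using (Star)

data Dir : Set where
  snd rcv : Dir

-- act s r d a  is  "s r ! a" (d = snd) or "s r ? a" (d = rcv)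
record Act (Role Msg : Set) : Set where
  constructor act
  field
    from : Role
    to   : Role
    dir  : Dir
    msg  : Msg

subject : ∀ {Role Msg} → Act Role Msg → Role
subject (act s r snd a) = s
subject (act s r rcv a) = r

record CFSM (Role Msg : Set) : Set where
  field
    size : ℕ
    init : Fin size
    δ    : List (Fin size × Act Role Msg × Fin size)

record Formalism : Set₁ where
  field
    Role  : Set
    _≟_   : DecidableEquality Role
    Msg   : Set
    GType : Set
    roles : GType → List Role
    msgs  : GType → List Msg
    proj  : GType → Role → CFSM Role Msg   -- G ↾ p  (meaningful for p ∈ P(G))
    wf : ∀ G p → p ∈ roles G → ∀ {q l q'} → (q , l , q') ∈ CFSM.δ (proj G p) →
         Act.from l ∈ roles G × Act.to l ∈ roles G × Act.from l ≢ Act.to l ×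
         Act.msg l ∈ msgs G × subject l ≡ p

module Theory (F : Formalism) where
  open Formalism F
  open CFSM
  open DecMem _≟_ using (_∈?_)

  M : Set
  M = CFSM Role Msg

  A : Set
  A = Act Role Msg

  State : M → Set
  State m = Fin (size m)

  Final : (m : M) → State m → Set
  Final m q = ∀ l q' → (q , l , q') ∈ δ m → ⊥

  Sending : (m : M) → State m → Set
  Sending m q = ¬ Final m q × (∀ l q' → (q , l , q') ∈ δ m → Act.dir l ≡ snd)

  Receiving : (m : M) → State m → Set
  Receiving m q = ¬ Final m q × (∀ l q' → (q , l , q') ∈ δ m → Act.dir l ≡ rcv)

  Mixed : (m : M) → State m → Set
  Mixed m q = ¬ Final m q × ¬ Sending m q × ¬ Receiving m q

  NoMixed : M → Set
  NoMixed m = ∀ q → ¬ Mixed m q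

  ?-det : M → Set
  ?-det m = ∀ {q q' q'' r s p p' a} →
    (q , act r s rcv a , q') ∈ δ m → (q , act p p' rcv a , q'') ∈ δ m → q' ≡ q''

  !-det : M → Set
  !-det m = ∀ {q q' q'' r s p p' a} →
    (q , act r s snd a , q') ∈ δ m → (q , act p p' snd a , q'') ∈ δ m → q' ≡ q''

  ?!-det : M → Set
  ?!-det m = ?-det m × !-det m

  -- Languages (all states accepting) and compatibility

  data Run (m : M) : State m → List A → Set where
    nil  : ∀ {q} → Run m q []
    cons : ∀ {q l q' w} → (q , l , q') ∈ δ m → Run m q' w → Run m q (l ∷ w)

  Lang : M → List A → Set
  Lang m w = Run m (init m) w

  ELabel : Set
  ELabel = Dir × Msg

  erase : A → ELabel
  erase (act _ _ d a) = d , a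

  flipDir : Dir → Dir
  flipDir snd = rcv
  flipDir rcv = snd

  dualE : A → ELabel
  dualE (act _ _ d a) = flipDir d , a

  InErased : M → List ELabel → Set
  InErased m w = ∃ λ u → Lang m u × map erase u ≡ w

  InDualErased : M → List ELabel → Set
  InDualErased m w = ∃ λ u → Lang m u × map dualE u ≡ w

  Compatible : M → M → Set
  Compatible m m' =
    (∀ w → (InErased m w → InDualErased m' w) × (InDualErased m' w → InErased m w)) ×
    NoMixed m × NoMixed m' × ?!-det m × ?!-det m'

  record System : Set where
    field
      rs   : List Role
      mach : Role → M           -- M_p (only used for p ∈ P)
  open System

  record Config (S : System) : Set where
    field
      st : (p : Role) → State (mach S p)
      ch : Role → Role → List Msg
  open Config

  Initial : (S : System) → Config S → Set
  Initial S c = (∀ p → st c p ≡ init (mach S p)) × (∀ x y → ch c x y ≡ [])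

  data Step (S : System) (c c' : Config S) : Set where
    send : ∀ {p r a q'} → p ∈ rs S →
           (st c p , act p r snd a , q') ∈ δ (mach S p) →
           st c' p ≡ q' → (∀ x → x ≢ p → st c' x ≡ st c x) →
           ch c' p r ≡ ch c p r ++ (a ∷ []) →
           (∀ x y → ¬ (x ≡ p × y ≡ r) → ch c' x y ≡ ch c x y) →
           Step S c c'
    recv : ∀ {s p a q'} → p ∈ rs S →
           (st c p , act s p rcv a , q') ∈ δ (mach S p) →
           st c' p ≡ q' → (∀ x → x ≢ p → st c' x ≡ st c x) →
           ch c s p ≡ a ∷ ch c' s p →
           (∀ x y → ¬ (x ≡ s × y ≡ p) → ch c' x y ≡ ch c x y) →
           Step S c c'

  Reachable : (S : System) → Config S → Set
  Reachable S c = ∃ λ c₀ → Initial S c₀ × Star (Step S) c₀ c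

  Deadlock : (S : System) → Config S → Set
  Deadlock S c =
    (∀ x y → x ∈ rs S → y ∈ rs S → ch c x y ≡ []) ×
    (∀ p → p ∈ rs S → Receiving (mach S p) (st c p))

  Orphan : (S : System) → Config S → Set
  Orphan S c =
    (∀ p → p ∈ rs S → Final (mach S p) (st c p)) ×
    (∃₂ λ x y → x ∈ rs S × y ∈ rs S × ¬ (ch c x y ≡ []))

  UnspecifiedReception : (S : System) → Config S → Set
  UnspecifiedReception S c = ∃ λ r → r ∈ rs S × Receiving (mach S r) (st c r) ×
    (∀ s a q' → (st c r , act s r rcv a , q') ∈ δ (mach S r) →
       ∃₂ λ b bs → ch c s r ≡ b ∷ bs × b ≢ a)

  Safe : System → Set
  Safe S = ∀ c → Reachable S c →
    ¬ Deadlock S c × ¬ Orphan S c × ¬ UnspecifiedReception S c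

  gw : M → Role → Role → M
  gw m H K = record
    { size = size m + length (δ m)
    ; init = init m ↑ˡ length (δ m)
    ; δ    = concat (tabulate (λ i → tr i (lookup (δ m) i)))
    }
    where
    T : Set
    T = Fin (size m + length (δ m)) × A × Fin (size m + length (δ m))
    emb : Fin (size m) → Fin (size m + length (δ m))
    emb q = q ↑ˡ length (δ m)
    fresh : Fin (length (δ m)) → Fin (size m + length (δ m))
    fresh i = size m ↑ʳ i
    tr : Fin (length (δ m)) → Fin (size m) × A × Fin (size m) → List T
    tr i (q , act x y snd a , q') =
      (emb q , act K H rcv a , fresh i) ∷ (fresh i , act x y snd a , emb q') ∷ []
    tr i (q , act x y rcv a , q') =
      (emb q , act x y rcv a , fresh i) ∷ (fresh i , act H K snd a , emb q') ∷ []

  compose : System → Role → Role → System → System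
  compose S₁ H K S₂ = record { rs = rs S₁ ++ rs S₂ ; mach = m }
    where
    m : Role → M
    m p with p ≟ H
    ... | yes _ = gw (mach S₁ H) H K
    ... | no _ with p ≟ K
    ...   | yes _ = gw (mach S₂ K) K H
    ...   | no _ with p ∈? rs S₁
    ...     | yes _ = mach S₁ p
    ...     | no _  = mach S₂ p

  data GTIR : Set where
    base : GType → List Role → GTIR
    comp : GTIR → Role → Role → GTIR → GTIR

  rolesT : GTIR → List Role
  rolesT (base G I) = roles G
  rolesT (comp t₁ H K t₂) = rolesT t₁ ++ rolesT t₂

  iface : GTIR → List Role
  iface (base G I) = I
  iface (comp t₁ H K t₂) =
    filter (λ p → ¬? (p ≟ H) ×-dec ¬? (p ≟ K)) (iface t₁ ++ iface t₂)

  components : GTIR → List GType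
  components (base G I) = G ∷ []
  components (comp t₁ H K t₂) = components t₁ ++ components t₂

  projT : GTIR → Role → M
  projT (base G I) p = proj G p
  projT (comp t₁ H K t₂) p with p ∈? rolesT t₁
  ... | yes _ = projT t₁ p
  ... | no _  = projT t₂ p

  baseSys : GType → System
  baseSys G = record { rs = roles G ; mach = proj G }

  sem : GTIR → System
  sem (base G I) = baseSys G
  sem (comp t₁ H K t₂) = compose (sem t₁) H K (sem t₂)

  IsGTIR : GTIR → Set
  IsGTIR (base G I) =
    I ⊆ roles G ×
    (∀ p → p ∈ roles G → ∀ {q l q'} → (q , l , q') ∈ δ (proj G p) →
       Act.from l ∈ I → Act.to l ∈ I → ⊥)
  IsGTIR (comp t₁ H K t₂) =
    IsGTIR t₁ × IsGTIR t₂ ×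
    (∀ p → p ∈ rolesT t₁ → p ∈ rolesT t₂ → ⊥) ×
    H ∈ iface t₁ × K ∈ iface t₂ ×
    Compatible (projT t₁ H) (projT t₂ K)

module Submission where

-- The base case is the hypothesis;
-- the composite case is the composition theorem (Composition.compose-safe):
-- if S₁ and S₂ are safe and well formed (their machines only talk to their
-- own roles) and the interface machines M_H, M_K are compatible, then
-- S₁ ⋈_{H,K} S₂ is safe.  That theorem rests on two facts.
--   * Restriction: forgetting the roles of the other side and reading the
--     gateway of H as the state of M_H it stands for, every reachable
--     configuration of the composite restricts to a reachable configuration
--     of S₁ (symmetrically for S₂).
--   * The pair invariant: the states of M_H and M_K underlying the two
--     gateways are reached by dual traces, up to a run of receptions of one
--     of them whose messages are exactly those in flight towards the other.
--     Compatibility (dual languages, determinism, no mixed states) makes it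
--     inductive.
-- A deadlock, orphan message or unspecified reception of the composite then
-- either restricts to one of a component, excluded by its safety, or
-- contradicts the invariant (module Side).

open import Defs
open import Data.List.Membership.Propositional using (_∈_; _∉_; find; lose)
open import Data.Nat using (ℕ)
open import Data.Fin using (Fin; splitAt; _↑ˡ_; _↑ʳ_)
open import Data.Fin.Properties using (splitAt-↑ˡ; splitAt-↑ʳ; join-splitAt; ↑ˡ-injective)
import Data.Fin.Properties as FinP
open import Data.List using (List; []; _∷_; _++_; length; map; concat; tabulate; lookup)
open import Data.List.Properties using (map-++; ++-assoc; ++-identityʳ; ∷-injectiveˡ; ∷-injectiveʳ)
open import Data.List.Membership.Propositional.Properties
  using (∈-concat⁺′; ∈-concat⁻′; ∈-tabulate⁺; ∈-tabulate⁻; ∈-++⁺ˡ; ∈-++⁺ʳ; ∈-++⁻; ∈-filter⁻; ∈-lookup)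
open import Data.List.Relation.Unary.Any using (here; there; any?) renaming (index to anyIndex)
open import Data.List.Relation.Unary.Any.Properties using (lookup-index)
open import Data.Product using (∃; ∃₂; _×_; _,_; proj₁; proj₂)
open import Data.Sum using (_⊎_; inj₁; inj₂)
open import Data.Empty using (⊥; ⊥-elim)
open import Relation.Nullary using (¬_; Dec; yes; no)
open import Relation.Nullary.Decidable using (_×-dec_; ¬?)
open import Relation.Binary.PropositionalEquality
open import Relation.Binary.Construct.Closure.ReflexiveTransitive using (Star; ε; _◅_; _◅◅_)
import Data.List.Membership.DecPropositional as DecMem

module CompositionSafety (F : Formalism) where
  open Formalism F
  open Theory F
  open CFSM
  open System
  open Config
  open DecMem _≟_ using (_∈?_)

  data Path (m : M) : State m → List A → State m → Set where
    [] : ∀ {q} → Path m q [] q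
    _∷_ : ∀ {q l q' w e} → (q , l , q') ∈ δ m → Path m q' w e → Path m q (l ∷ w) e

  run→path : ∀ {m q w} → Run m q w → ∃ λ e → Path m q w e
  run→path nil = _ , []
  run→path (cons t r) = let e , p = run→path r in e , t ∷ p

  path→run : ∀ {m q w e} → Path m q w e → Run m q w
  path→run [] = nil
  path→run (t ∷ p) = cons t (path→run p)

  path-snoc : ∀ {m q w e l e'} → Path m q w e → (e , l , e') ∈ δ m → Path m q (w ++ l ∷ []) e'
  path-snoc [] t = t ∷ []
  path-snoc (t' ∷ p) t = t' ∷ path-snoc p t

  path-unsnoc : ∀ {m q} w {l e'} → Path m q (w ++ l ∷ []) e' →
    ∃ λ e → Path m q w e × (e , l , e') ∈ δ m
  path-unsnoc [] (t ∷ []) = _ , [] , t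
  path-unsnoc (_ ∷ w) (t ∷ p) = let e , p' , t' = path-unsnoc w p in e , t ∷ p' , t'

  det-step : ∀ {m} → ?!-det m → ∀ {q l l' q' q''} → (q , l , q') ∈ δ m →
    (q , l' , q'') ∈ δ m → erase l ≡ erase l' → q' ≡ q''
  det-step (det? , det!) {l = act _ _ snd _} {act _ _ snd _} t t' refl = det! t t'
  det-step (det? , det!) {l = act _ _ rcv _} {act _ _ rcv _} t t' refl = det? t t'

  det-path : ∀ {m} → ?!-det m → ∀ {q u u' e e'} → Path m q u e → Path m q u' e' →
    map erase u ≡ map erase u' → e ≡ e'
  det-path d [] [] _ = refl
  det-path {m} d (t ∷ p) (t' ∷ p') eq with det-step {m} d t t' (∷-injectiveˡ eq)
  ... | refl = det-path {m} d p p' (∷-injectiveʳ eq)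

  flipE : ELabel → ELabel
  flipE (d , a) = flipDir d , a

  map-flipE-involutive : ∀ w → map flipE (map flipE w) ≡ w
  map-flipE-involutive [] = refl
  map-flipE-involutive ((snd , a) ∷ w) = cong (_ ∷_) (map-flipE-involutive w)
  map-flipE-involutive ((rcv , a) ∷ w) = cong (_ ∷_) (map-flipE-involutive w)

  dual≡flip-erase : ∀ u → map dualE u ≡ map flipE (map erase u)
  dual≡flip-erase [] = refl
  dual≡flip-erase (act _ _ _ _ ∷ u) = cong (_ ∷_) (dual≡flip-erase u)

  erase≡flip-dual : ∀ u → map erase u ≡ map flipE (map dualE u)
  erase≡flip-dual u = begin
    map erase u                           ≡⟨ map-flipE-involutive (map erase u) ⟨
    map flipE (map flipE (map erase u))   ≡⟨ cong (map flipE) (dual≡flip-erase u) ⟨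
    map flipE (map dualE u)               ∎
    where open ≡-Reasoning

  map-≡-snoc : ∀ {X Y : Set} (f : X → Y) xs ys z → map f xs ≡ ys ++ z ∷ [] →
    ∃₂ λ xs' x → xs ≡ xs' ++ x ∷ [] × map f xs' ≡ ys × f x ≡ z
  map-≡-snoc f (x ∷ []) [] z eq = [] , x , refl , refl , ∷-injectiveˡ eq
  map-≡-snoc f (x ∷ _ ∷ _) [] z eq with ∷-injectiveʳ eq
  ... | ()
  map-≡-snoc f (x ∷ xs) (y ∷ ys) z eq with map-≡-snoc f xs ys z (∷-injectiveʳ eq)
  ... | xs' , l , refl , refl , e = x ∷ xs' , l , refl , cong (_∷ _) (∷-injectiveˡ eq) , e

  Synced : (mA mB : M) → State mA → State mB → Set
  Synced mA mB x y = ∃₂ λ u v →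
    Path mA (init mA) u x × Path mB (init mB) v y × map erase u ≡ map dualE v

  synced-init : ∀ mA mB → Synced mA mB (init mA) (init mB)
  synced-init mA mB = [] , [] , [] , [] , refl

  synced-sym : ∀ {mA mB x y} → Synced mA mB x y → Synced mB mA y x
  synced-sym (u , v , pu , pv , eq) = v , u , pv , pu , (begin
    map erase v               ≡⟨ erase≡flip-dual v ⟩
    map flipE (map dualE v)   ≡⟨ cong (map flipE) eq ⟨
    map flipE (map erase u)   ≡⟨ dual≡flip-erase u ⟨
    map dualE u               ∎)
    where open ≡-Reasoning

  synced-step : ∀ {mA mB x y lA x' lB y'} → Synced mA mB x y →
    (x , lA , x') ∈ δ mA → (y , lB , y') ∈ δ mB → erase lA ≡ dualE lB → Synced mA mB x' y'
  synced-step {lA = lA} {lB = lB} (u , v , pu , pv , eq) tA tB e =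
    _ , _ , path-snoc pu tA , path-snoc pv tB , (begin
      map erase (u ++ lA ∷ [])         ≡⟨ map-++ erase u _ ⟩
      map erase u ++ erase lA ∷ []     ≡⟨ cong₂ (λ w l → w ++ l ∷ []) eq e ⟩
      map dualE v ++ dualE lB ∷ []     ≡⟨ map-++ dualE v _ ⟨
      map dualE (v ++ lB ∷ [])         ∎)
    where open ≡-Reasoning

  record Compat (mA mB : M) : Set where
    field
      to-dual   : ∀ w → InErased mA w → InDualErased mB w
      from-dual : ∀ w → InDualErased mB w → InErased mA w
      detA : ?!-det mA
      detB : ?!-det mB
      no-mixedA : NoMixed mA
      no-mixedB : NoMixed mB
  open Compat

  fromCompatible : ∀ {mA mB} → Compatible mA mB → Compat mA mB
  fromCompatible (lang , nA , nB , dA , dB) = record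
    { to-dual = λ w → proj₁ (lang w) ; from-dual = λ w → proj₂ (lang w)
    ; detA = dA ; detB = dB ; no-mixedA = nA ; no-mixedB = nB }

  -- Compatibility is symmetric: flip both sides of the language equation.
  compat-sym : ∀ {mA mB} → Compat mA mB → Compat mB mA
  compat-sym {mA} {mB} c = record
    { to-dual = to ; from-dual = from ; detA = detB c ; detB = detA c
    ; no-mixedA = no-mixedB c ; no-mixedB = no-mixedA c }
    where
    to : ∀ w → InErased mB w → InDualErased mA w
    to w (u , run , eq)
      with from-dual c (map flipE w) (u , run , trans (dual≡flip-erase u) (cong (map flipE) eq))
    ... | u' , run' , eq' =
      u' , run' , trans (dual≡flip-erase u') (trans (cong (map flipE) eq') (map-flipE-involutive w))
    from : ∀ w → InDualErased mA w → InErased mB w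
    from w (u , run , eq)
      with to-dual c (map flipE w) (u , run , trans (erase≡flip-dual u) (cong (map flipE) eq))
    ... | v , run' , eq' =
      v , run' , trans (erase≡flip-dual v) (trans (cong (map flipE) eq') (map-flipE-involutive w))

  -- The key consequence of compatibility: from synchronised states, every
  -- move of A is answered by a dual move of B, again reaching synchronised
  -- states (language inclusion gives the move, determinism pins down its source).
  compat-answer : ∀ {mA mB x y lA x'} → Compat mA mB → Synced mA mB x y →
    (x , lA , x') ∈ δ mA →
    ∃₂ λ lB y' → (y , lB , y') ∈ δ mB × dualE lB ≡ erase lA × Synced mA mB x' y'
  compat-answer {mA} {mB} {lA = lA} c (u , v , pu , pv , eq) tA
    with to-dual c _ (u ++ lA ∷ [] , path→run (path-snoc pu tA) , refl)
  ... | v' , runv' , eq'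
    with map-≡-snoc dualE v' (map dualE v) (erase lA)
           (trans eq' (trans (map-++ erase u (lA ∷ [])) (cong (_++ erase lA ∷ []) eq)))
  ... | v'' , lB , refl , eqv , eqB
    with run→path runv'
  ... | y' , pv'
    with path-unsnoc v'' pv'
  ... | y , pv'' , tB
    with det-path {mB} (detB c) pv'' pv
           (trans (erase≡flip-dual v'') (trans (cong (map flipE) eqv) (sym (erase≡flip-dual v))))
  ... | refl = lB , y' , tB , eqB , synced-step (u , v , pu , pv , eq) tA tB (sym eqB)

  not-mixed : ∀ {m q l₁ q₁ l₂ q₂} → NoMixed m → (q , l₁ , q₁) ∈ δ m → (q , l₂ , q₂) ∈ δ m →
    Act.dir l₁ ≡ snd → Act.dir l₂ ≡ rcv → ⊥
  not-mixed {q = q} nm t₁ t₂ d₁ d₂ =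
    nm q ((λ fin → fin _ _ t₁) , (λ s → snd≢rcv (trans (sym (proj₂ s _ _ t₂)) d₂)) ,
          (λ r → snd≢rcv (trans (sym d₁) (proj₂ r _ _ t₁))))
    where
    snd≢rcv : snd ≢ rcv
    snd≢rcv ()

  dualE-rcv : ∀ {l : A} {b} → dualE l ≡ (rcv , b) → l ≡ act (Act.from l) (Act.to l) snd b
  dualE-rcv {act _ _ snd _} refl = refl

  dualE-snd : ∀ {l : A} {b} → dualE l ≡ (snd , b) → Act.dir l ≡ rcv
  dualE-snd {act _ _ rcv _} refl = refl

  erase-snd : ∀ {l : A} → Act.dir l ≡ snd → erase l ≡ (snd , Act.msg l)
  erase-snd {act _ _ snd _} refl = refl

  data RcvPath (m : M) : State m → List Msg → State m → Set where
    [] : ∀ {q} → RcvPath m q [] q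
    _∷_ : ∀ {q x y a q' ms e} → (q , act x y rcv a , q') ∈ δ m → RcvPath m q' ms e →
          RcvPath m q (a ∷ ms) e

  rcvpath-snoc : ∀ {m q ms e x y a e'} → RcvPath m q ms e → (e , act x y rcv a , e') ∈ δ m →
    RcvPath m q (ms ++ a ∷ []) e'
  rcvpath-snoc [] t = t ∷ []
  rcvpath-snoc (t' ∷ p) t = t' ∷ rcvpath-snoc p t

  -- A (at a) is ahead of B (at b): from a state synchronised with b, A has
  -- performed receptions of exactly the messages qAB that B still has to
  -- send, and nothing is in flight towards A.
  Ahead : (mA mB : M) → State mA → State mB → List Msg → List Msg → Set
  Ahead mA mB a b qAB qBA = qBA ≡ [] × ∃ λ x → Synced mA mB x b × RcvPath mA x qAB a

  SyncInv : (mA mB : M) → State mA → State mB → List Msg → List Msg → Set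
  SyncInv mA mB a b qAB qBA = Ahead mA mB a b qAB qBA ⊎ Ahead mB mA b a qBA qAB

  syncinv-sym : ∀ {mA mB a b qAB qBA} → SyncInv mA mB a b qAB qBA → SyncInv mB mA b a qBA qAB
  syncinv-sym (inj₁ x) = inj₂ x
  syncinv-sym (inj₂ y) = inj₁ y

  syncinv-init : ∀ mA mB → SyncInv mA mB (init mA) (init mB) [] []
  syncinv-init mA mB = inj₁ (refl , init mA , synced-init mA mB , [])

  syncinv-send : ∀ {mA mB a b qAB c qBA l a'} → SyncInv mA mB a b qAB (c ∷ qBA) →
    (a , l , a') ∈ δ mA → erase l ≡ (snd , c) → SyncInv mA mB a' b qAB qBA
  syncinv-send (inj₂ (refl , y , s , tB ∷ p)) t e =
    inj₂ (refl , _ , synced-sym (synced-step (synced-sym s) t tB e) , p)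

  -- A reception of A extends the lead of A; B cannot be strictly ahead at
  -- that moment, since A would then also have to be able to send (mixed state).
  syncinv-receive : ∀ {mA mB a b qAB qBA x y c a'} → Compat mA mB → SyncInv mA mB a b qAB qBA →
    (a , act x y rcv c , a') ∈ δ mA → SyncInv mA mB a' b (qAB ++ c ∷ []) qBA
  syncinv-receive cm (inj₁ (e , x , s , p)) t = inj₁ (e , x , s , rcvpath-snoc p t)
  syncinv-receive {a = a} cm (inj₂ (refl , y , s , [])) t =
    inj₁ (refl , a , synced-sym s , t ∷ [])
  syncinv-receive {mA} cm (inj₂ (refl , y , s , tB ∷ _)) t
    with compat-answer (compat-sym cm) s tB
  ... | lA , _ , tA , e , _ with dualE-rcv {lA} e
  ... | refl = ⊥-elim (not-mixed {mA} (no-mixedA cm) tA t refl refl)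

  syncinv-empty : ∀ {mA mB a b} → SyncInv mA mB a b [] [] → Synced mA mB a b
  syncinv-empty (inj₁ (_ , _ , s , [])) = s
  syncinv-empty (inj₂ (_ , _ , s , [])) = synced-sym s

  -- Nothing is in flight towards a machine in a final state: its partner
  -- cannot be ahead, as B would have to answer the first reception.
  syncinv-final : ∀ {mA mB a b qAB qBA} → Compat mA mB → SyncInv mA mB a b qAB qBA →
    Final mB b → qAB ≡ []
  syncinv-final cm (inj₁ (_ , _ , s , [])) fin = refl
  syncinv-final cm (inj₁ (_ , _ , s , tA ∷ _)) fin =
    let _ , _ , tB , _ = compat-answer cm s tA in ⊥-elim (fin _ _ tB)
  syncinv-final cm (inj₂ (e , _)) fin = e

  syncinv-pending : ∀ {mA mB a b qAB c qBA} → Compat mA mB → SyncInv mA mB a b qAB (c ∷ qBA) →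
    ∃₂ λ x y → ∃ λ a' → (a , act x y snd c , a') ∈ δ mA
  syncinv-pending cm (inj₂ (_ , _ , s , tB ∷ _)) with compat-answer (compat-sym cm) s tB
  ... | lA , _ , tA , e , _ with dualE-rcv {lA} e
  ... | refl = _ , _ , _ , tA

  is-snd? : (d : Dir) → Dec (d ≡ snd)
  is-snd? snd = yes refl
  is-snd? rcv = no (λ ())

  HasSend : (m : M) → State m → Set
  HasSend m q = ∃₂ λ l q' → (q , l , q') ∈ δ m × Act.dir l ≡ snd

  has-send? : (m : M) (q : State m) → Dec (HasSend m q)
  has-send? m q with any? (λ (p , l , _) → p FinP.≟ q ×-dec is-snd? (Act.dir l)) (δ m)
  ... | yes t∈ with find t∈
  ...   | (_ , l , q') , t , refl , d = yes (l , q' , t , d)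
  has-send? m q | no ¬t∈ = no (λ (l , q' , t , d) → ¬t∈ (lose t (refl , d)))

  no-send→rcv : ∀ {m q l q'} → ¬ HasSend m q → (q , l , q') ∈ δ m → Act.dir l ≡ rcv
  no-send→rcv {l = act _ _ snd _} ns t = ⊥-elim (ns (_ , _ , t , refl))
  no-send→rcv {l = act _ _ rcv _} ns t = refl

  block-⊆ : ∀ {T : Set} {n} {f : Fin n → List T} xs → xs ≡ concat (tabulate f) →
    ∀ i {t} → t ∈ f i → t ∈ xs
  block-⊆ _ refl i t∈ = ∈-concat⁺′ t∈ (∈-tabulate⁺ i)

  block-∈ : ∀ {T : Set} {n} {f : Fin n → List T} xs → xs ≡ concat (tabulate f) →
    ∀ {t} → t ∈ xs → ∃ λ i → t ∈ f i
  block-∈ {f = f} _ refl t∈ with ∈-concat⁻′ (tabulate f) t∈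
  ... | _ , t∈b , b∈ with ∈-tabulate⁻ {f = f} b∈
  ... | i , refl = i , t∈b

  module Gateway (m : M) (H K : Role) where
    g : M
    g = gw m H K

    n : ℕ
    n = length (δ m)

    emb : State m → State g
    emb q = q ↑ˡ n

    fresh : Fin n → State g
    fresh i = size m ↑ʳ i

    state-view : ∀ s → (∃ λ q → s ≡ emb q) ⊎ (∃ λ i → s ≡ fresh i)
    state-view s with splitAt (size m) s | join-splitAt (size m) n s
    ... | inj₁ q | refl = inj₁ (q , refl)
    ... | inj₂ i | refl = inj₂ (i , refl)

    emb-injective : ∀ {q q'} → emb q ≡ emb q' → q ≡ q'
    emb-injective = ↑ˡ-injective n _ _

    emb≢fresh : ∀ {q i} → emb q ≢ fresh i
    emb≢fresh {q} {i} e
      with trans (sym (splitAt-↑ˡ (size m) q n)) (trans (cong (splitAt (size m)) e) (splitAt-↑ʳ (size m) n i))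
    ... | ()

    -- What a gateway state means for the protocol: the state of m it stands
    -- for, the message received from K still to be forwarded inside (pending
    -- input), and the message received inside still to be sent to K
    -- (pending output).  Midway through the forwarding of an m-send the
    -- m-transition has not happened yet; midway through an m-receive it has.
    Summary : Set
    Summary = State m × List Msg × List Msg

    summaryT : State m × A × State m → Summary
    summaryT (q , act _ _ snd a , q') = q , a ∷ [] , []
    summaryT (q , act _ _ rcv a , q') = q' , [] , a ∷ []

    summary : State g → Summary
    summary s with splitAt (size m) s
    ... | inj₁ q = q , [] , []
    ... | inj₂ i = summaryT (lookup (δ m) i)

    underlying : State g → State m
    underlying s = proj₁ (summary s)

    summary-emb : ∀ q → summary (emb q) ≡ (q , [] , [])
    summary-emb q rewrite splitAt-↑ˡ (size m) q n = refl

    summary-fresh : ∀ {i t} → lookup (δ m) i ≡ t → summary (fresh i) ≡ summaryT t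
    summary-fresh {i} refl rewrite splitAt-↑ʳ (size m) n i = refl

    underlying-emb : ∀ q → underlying (emb q) ≡ q
    underlying-emb q = cong proj₁ (summary-emb q)

    underlying-fresh : ∀ {i t} → lookup (δ m) i ≡ t → underlying (fresh i) ≡ proj₁ (summaryT t)
    underlying-fresh e = cong proj₁ (summary-fresh e)

    data GwStep : State g → A → State g → Set where
      send-in  : ∀ i {q x y a q'} → lookup (δ m) i ≡ (q , act x y snd a , q') →
                 GwStep (emb q) (act K H rcv a) (fresh i)
      send-out : ∀ i {q x y a q'} → lookup (δ m) i ≡ (q , act x y snd a , q') →
                 GwStep (fresh i) (act x y snd a) (emb q')
      recv-in  : ∀ i {q x y a q'} → lookup (δ m) i ≡ (q , act x y rcv a , q') →
                 GwStep (emb q) (act x y rcv a) (fresh i)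
      recv-out : ∀ i {q x y a q'} → lookup (δ m) i ≡ (q , act x y rcv a , q') →
                 GwStep (fresh i) (act H K snd a) (emb q')

    gw-inv : ∀ {s l s'} → (s , l , s') ∈ δ g → GwStep s l s'
    gw-inv t∈ with block-∈ (δ g) refl t∈
    ... | i , t∈b with lookup (δ m) i in e
    ... | (_ , act _ _ snd _ , _) with t∈b
    ...   | here refl = send-in i e
    ...   | there (here refl) = send-out i e
    gw-inv t∈ | i , t∈b | (_ , act _ _ rcv _ , _) with t∈b
    ...   | here refl = recv-in i e
    ...   | there (here refl) = recv-out i e

    send-in∈ : ∀ i {q x y a q'} → lookup (δ m) i ≡ (q , act x y snd a , q') →
      (emb q , act K H rcv a , fresh i) ∈ δ g
    send-in∈ i e with lookup (δ m) i | block-⊆ (δ g) refl i | e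
    ... | _ | ⊆δ | refl = ⊆δ (here refl)

    send-out∈ : ∀ i {q x y a q'} → lookup (δ m) i ≡ (q , act x y snd a , q') →
      (fresh i , act x y snd a , emb q') ∈ δ g
    send-out∈ i e with lookup (δ m) i | block-⊆ (δ g) refl i | e
    ... | _ | ⊆δ | refl = ⊆δ (there (here refl))

    recv-in∈ : ∀ i {q x y a q'} → lookup (δ m) i ≡ (q , act x y rcv a , q') →
      (emb q , act x y rcv a , fresh i) ∈ δ g
    recv-in∈ i e with lookup (δ m) i | block-⊆ (δ g) refl i | e
    ... | _ | ⊆δ | refl = ⊆δ (here refl)

    recv-out∈ : ∀ i {q x y a q'} → lookup (δ m) i ≡ (q , act x y rcv a , q') →
      (fresh i , act H K snd a , emb q') ∈ δ g
    recv-out∈ i e with lookup (δ m) i | block-⊆ (δ g) refl i | e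
    ... | _ | ⊆δ | refl = ⊆δ (there (here refl))

    index : ∀ {t} → t ∈ δ m → ∃ λ i → lookup (δ m) i ≡ t
    index t∈ = anyIndex t∈ , sym (lookup-index t∈)

    lookup∈ : ∀ {i t} → lookup (δ m) i ≡ t → t ∈ δ m
    lookup∈ {i} e = subst (_∈ δ m) e (∈-lookup i)

    lift-send : ∀ {q x y a q'} → (q , act x y snd a , q') ∈ δ m →
      ∃ λ s' → (emb q , act K H rcv a , s') ∈ δ g
    lift-send t = let i , e = index t in fresh i , send-in∈ i e

    lift-recv : ∀ {q x y a q'} → (q , act x y rcv a , q') ∈ δ m →
      ∃ λ s' → (emb q , act x y rcv a , s') ∈ δ g
    lift-recv t = let i , e = index t in fresh i , recv-in∈ i e

    lift : ∀ {q l q'} → (q , l , q') ∈ δ m → ∃₂ λ l' s' → (emb q , l' , s') ∈ δ g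
    lift {l = act _ _ snd _} t = _ , lift-send t
    lift {l = act _ _ rcv _} t = _ , lift-recv t

    unlift : ∀ {q l s'} → (emb q , l , s') ∈ δ g → ∃₂ λ l' q' → (q , l' , q') ∈ δ m
    unlift {q} t = from (gw-inv t) refl
      where
      from : ∀ {s l s'} → GwStep s l s' → s ≡ emb q → ∃₂ λ l' q' → (q , l' , q') ∈ δ m
      from (send-in i e) eq with emb-injective eq
      ... | refl = _ , _ , lookup∈ e
      from (recv-in i e) eq with emb-injective eq
      ... | refl = _ , _ , lookup∈ e
      from (send-out i e) eq = ⊥-elim (emb≢fresh (sym eq))
      from (recv-out i e) eq = ⊥-elim (emb≢fresh (sym eq))

    fresh-sends : ∀ i → HasSend g (fresh i)
    fresh-sends i with lookup (δ m) i in e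
    ... | (_ , act _ _ snd _ , _) = _ , _ , send-out∈ i e , refl
    ... | (_ , act _ _ rcv _ , _) = _ , _ , recv-out∈ i e , refl

    receiving-emb : ∀ {s} → Receiving g s → ∃ λ q → s ≡ emb q
    receiving-emb {s} (_ , rcv-only) with state-view s
    ... | inj₁ x = x
    ... | inj₂ (i , refl) with fresh-sends i
    ...   | l , s' , t , d with trans (sym d) (rcv-only l s' t)
    ...     | ()

    final-emb : ∀ {s} → Final g s → ∃ λ q → s ≡ emb q
    final-emb {s} fin with state-view s
    ... | inj₁ x = x
    ... | inj₂ (i , refl) = let l , s' , t , _ = fresh-sends i in ⊥-elim (fin l s' t)

    final-unlift : ∀ {q} → Final g (emb q) → Final m q
    final-unlift fin l q' t = let l' , s' , t' = lift t in fin l' s' t'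

    receiving-unlift : ∀ {q} → Receiving g (emb q) → ¬ HasSend m q → Receiving m q
    receiving-unlift (¬fin , _) ns =
      (λ fin → ¬fin (λ l s' t → let l' , q' , t' = unlift t in fin l' q' t')) ,
      (λ l q' t → no-send→rcv {m} ns t)

    gw-talks-within : (P : Role → Set) → P H → P K →
      (∀ {q l q'} → (q , l , q') ∈ δ m → P (Act.from l) × P (Act.to l)) →
      ∀ {s l s'} → (s , l , s') ∈ δ g → P (Act.from l) × P (Act.to l)
    gw-talks-within P pH pK pm t with gw-inv t
    ... | send-in _ _ = pK , pH
    ... | send-out _ e = pm (lookup∈ e)
    ... | recv-in _ e = pm (lookup∈ e)
    ... | recv-out _ _ = pH , pK

  cast : ∀ {m m' : M} → m ≡ m' → State m → State m'
  cast e = subst State e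

  cast-irrelevant : ∀ {m m' : M} (e e' : m ≡ m') s → cast e s ≡ cast e' s
  cast-irrelevant refl refl s = refl

  cast-init : ∀ {m m' : M} (e : m ≡ m') → cast e (init m) ≡ init m'
  cast-init refl = refl

  cast-δ : ∀ {m m' : M} (e : m ≡ m') {s l s'} → (s , l , s') ∈ δ m → (cast e s , l , cast e s') ∈ δ m'
  cast-δ refl t = t

  cast-δ⁻ : ∀ {m m' : M} (e : m ≡ m') {s l s'} → (cast e s , l , s') ∈ δ m' →
    (s , l , cast (sym e) s') ∈ δ m
  cast-δ⁻ refl t = t

  cast-receiving : ∀ {m m' : M} (e : m ≡ m') {s} → Receiving m s → Receiving m' (cast e s)
  cast-receiving refl r = r

  cast-final : ∀ {m m' : M} (e : m ≡ m') {s} → Final m s → Final m' (cast e s)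
  cast-final refl f = f

  -- Configurations agreeing pointwise (configurations contain functions,
  -- so this is weaker than equality).
  _≈_ : ∀ {S} → Config S → Config S → Set
  c ≈ c' = (∀ p → st c p ≡ st c' p) × (∀ x y → ch c x y ≡ ch c' x y)

  step-≈ : ∀ {S c d d'} → Step S c d → d ≈ d' → Step S c d'
  step-≈ (send p∈ t stp fr chp chfr) (e₁ , e₂) =
    send p∈ t (trans (sym (e₁ _)) stp) (λ x ne → trans (sym (e₁ x)) (fr x ne))
      (trans (sym (e₂ _ _)) chp) (λ x y n → trans (sym (e₂ x y)) (chfr x y n))
  step-≈ (recv p∈ t stp fr chp chfr) (e₁ , e₂) =
    recv p∈ t (trans (sym (e₁ _)) stp) (λ x ne → trans (sym (e₁ x)) (fr x ne))
      (trans chp (cong (_ ∷_) (e₂ _ _))) (λ x y n → trans (sym (e₂ x y)) (chfr x y n))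

  initial-≈ : ∀ {S c c'} → Initial S c → c ≈ c' → Initial S c'
  initial-≈ (i₁ , i₂) (e₁ , e₂) =
    (λ p → trans (sym (e₁ p)) (i₁ p)) , (λ x y → trans (sym (e₂ x y)) (i₂ x y))

  reachable-≈ : ∀ {S c c'} → Reachable S c → c ≈ c' → Reachable S c'
  reachable-≈ {S} (c₀ , ini , steps) e with last steps e
    where
    last : ∀ {a b b'} → Star (Step S) a b → b ≈ b' → (a ≈ b') ⊎ Star (Step S) a b'
    last ε e = inj₁ e
    last (s ◅ ss) e with last ss e
    ... | inj₁ e' = inj₂ (step-≈ {S} s e' ◅ ε)
    ... | inj₂ ss' = inj₂ (s ◅ ss')
  ... | inj₁ e' = _ , initial-≈ {S} ini e' , ε
  ... | inj₂ steps' = c₀ , ini , steps'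

  reachable-step : ∀ {S c c'} → Reachable S c → Step S c c' → Reachable S c'
  reachable-step (c₀ , ini , steps) s = c₀ , ini , (steps ◅◅ (s ◅ ε))

  reachable-ind : ∀ {S} (P : Config S → Set) →
    (∀ {c} → Initial S c → P c) →
    (∀ {c c'} → Reachable S c → Step S c c' → P c → P c') →
    ∀ {c} → Reachable S c → P c
  reachable-ind {S} P init-P step-P (c₀ , ini , steps) = proj₂ (go steps ((c₀ , ini , ε) , init-P ini))
    where
    go : ∀ {a b} → Star (Step S) a b → Reachable S a × P a → Reachable S b × P b
    go ε rp = rp
    go (s ◅ ss) (r , p) = go ss (reachable-step r s , step-P r s p)

  -- A system is well formed if its machines only talk among its roles
  -- (true of projections, and preserved by composition).
  WellFormed : System → Set
  WellFormed S = ∀ p → p ∈ rs S → ∀ {q l q'} → (q , l , q') ∈ δ (mach S p) →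
    Act.from l ∈ rs S × Act.to l ∈ rs S

  CanSendOn : (S : System) → Role → Role → Set
  CanSendOn S x y = x ∈ rs S × ∃₂ λ q a → ∃ λ q' → (q , act x y snd a , q') ∈ δ (mach S x)

  nonempty-sender : ∀ {S c} → Reachable S c → ∀ x y → ch c x y ≢ [] → CanSendOn S x y
  nonempty-sender {S} = reachable-ind (λ c → ∀ x y → ch c x y ≢ [] → CanSendOn S x y) base-case step-case
    where
    base-case : ∀ {c} → Initial S c → ∀ x y → ch c x y ≢ [] → CanSendOn S x y
    base-case (_ , empty) x y ne = ⊥-elim (ne (empty x y))
    step-case : ∀ {c c'} → Reachable S c → Step S c c' →
      (∀ x y → ch c x y ≢ [] → CanSendOn S x y) → ∀ x y → ch c' x y ≢ [] → CanSendOn S x y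
    step-case _ (send {p} {r} p∈ t _ _ _ chfr) IH x y ne with x ≟ p | y ≟ r
    ... | yes refl | yes refl = p∈ , _ , _ , _ , t
    ... | no x≢p | _ = IH x y (λ e → ne (trans (chfr x y (λ (e' , _) → x≢p e')) e))
    ... | yes _ | no y≢r = IH x y (λ e → ne (trans (chfr x y (λ (_ , e') → y≢r e')) e))
    step-case _ (recv {s} {p} _ _ _ _ chp chfr) IH x y ne with x ≟ s | y ≟ p
    ... | yes refl | yes refl = IH x y (λ e → ∷≢[] (trans (sym chp) e))
      where
      ∷≢[] : ∀ {a : Msg} {as : List Msg} → a ∷ as ≢ []
      ∷≢[] ()
    ... | no x≢s | _ = IH x y (λ e → ne (trans (chfr x y (λ (e' , _) → x≢s e')) e))
    ... | yes _ | no y≢p = IH x y (λ e → ne (trans (chfr x y (λ (_ , e') → y≢p e')) e))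

  -- Forgetting the roles outside S, the channels leaving
  -- S and the forwarding progress of G maps runs of C to runs of S.
  module Restriction (C S : System) (G O : Role) (G∈ : G ∈ rs S) (O∉ : O ∉ rs S)
    (eq-other : ∀ p → p ∈ rs S → p ≢ G → mach C p ≡ mach S p)
    (eq-G : mach C G ≡ gw (mach S G) G O) (wf : WellFormed S) where
    open Gateway (mach S G) G O

    gateway-state : Config C → State g
    gateway-state c = cast eq-G (st c G)

    restrict-st : Config C → (p : Role) → State (mach S p)
    restrict-st c p with p ∈? rs S
    ... | no _ = init (mach S p)
    ... | yes p∈ with p ≟ G
    ...   | yes refl = underlying (gateway-state c)
    ...   | no p≢G = cast (eq-other p p∈ p≢G) (st c p)

    restrict-ch : Config C → Role → Role → List Msg
    restrict-ch c x y with x ∈? rs S | y ∈? rs S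
    ... | yes _ | yes _ = ch c x y
    ... | _     | _     = []

    restrict : Config C → Config S
    restrict c = record { st = restrict-st c ; ch = restrict-ch c }

    restrict-G : ∀ c → restrict-st c G ≡ underlying (gateway-state c)
    restrict-G c with G ∈? rs S
    ... | no G∉ = ⊥-elim (G∉ G∈)
    ... | yes _ with G ≟ G
    ...   | yes refl = refl
    ...   | no G≢G = ⊥-elim (G≢G refl)

    restrict-other : ∀ c p (p∈ : p ∈ rs S) (p≢G : p ≢ G) →
      restrict-st c p ≡ cast (eq-other p p∈ p≢G) (st c p)
    restrict-other c p p∈ p≢G with p ∈? rs S
    ... | no p∉ = ⊥-elim (p∉ p∈)
    ... | yes p∈' with p ≟ G
    ...   | yes p≡G = ⊥-elim (p≢G p≡G)
    ...   | no p≢G' = cast-irrelevant (eq-other p p∈' p≢G') (eq-other p p∈ p≢G) (st c p)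

    restrict-ch-in : ∀ c x y → x ∈ rs S → y ∈ rs S → restrict-ch c x y ≡ ch c x y
    restrict-ch-in c x y x∈ y∈ with x ∈? rs S | y ∈? rs S
    ... | yes _ | yes _ = refl
    ... | yes _ | no y∉ = ⊥-elim (y∉ y∈)
    ... | no x∉ | _ = ⊥-elim (x∉ x∈)

    restrict-st-≡ : ∀ c c' p → (p ∈ rs S → st c p ≡ st c' p) → restrict-st c p ≡ restrict-st c' p
    restrict-st-≡ c c' p h with p ∈? rs S
    ... | no _ = refl
    ... | yes p∈ with p ≟ G
    ...   | yes refl = cong (λ s → underlying (cast eq-G s)) (h p∈)
    ...   | no p≢G = cong (cast (eq-other p p∈ p≢G)) (h p∈)

    restrict-ch-≡ : ∀ c c' x y → (x ∈ rs S → y ∈ rs S → ch c x y ≡ ch c' x y) →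
      restrict-ch c x y ≡ restrict-ch c' x y
    restrict-ch-≡ c c' x y h with x ∈? rs S | y ∈? rs S
    ... | yes x∈ | yes y∈ = h x∈ y∈
    ... | yes _  | no _   = refl
    ... | no _   | _      = refl

    invisible : ∀ c c' → (∀ p → p ∈ rs S → p ≢ G → st c p ≡ st c' p) →
      underlying (gateway-state c) ≡ underlying (gateway-state c') →
      (∀ x y → x ∈ rs S → y ∈ rs S → ch c x y ≡ ch c' x y) → restrict c ≈ restrict c'
    invisible c c' h h-G h-ch = states , λ x y → restrict-ch-≡ c c' x y (h-ch x y)
      where
      states : ∀ p → restrict-st c p ≡ restrict-st c' p
      states p with p ∈? rs S
      ... | no _ = refl
      ... | yes p∈ with p ≟ G
      ...   | yes refl = h-G
      ...   | no p≢G = cong (cast (eq-other p p∈ p≢G)) (h p p∈ p≢G)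

    restrict-initial : ∀ {c} → Initial C c → Initial S (restrict c)
    restrict-initial {c} (i₁ , i₂) = states , channels
      where
      states : ∀ p → restrict-st c p ≡ init (mach S p)
      states p with p ∈? rs S
      ... | no _ = refl
      ... | yes p∈ with p ≟ G
      ...   | yes refl = trans (cong (λ s → underlying (cast eq-G s)) (i₁ G))
                           (trans (cong underlying (cast-init eq-G)) (underlying-emb _))
      ...   | no p≢G = trans (cong (cast (eq-other p p∈ p≢G)) (i₁ p)) (cast-init (eq-other p p∈ p≢G))
      channels : ∀ x y → restrict-ch c x y ≡ []
      channels x y with x ∈? rs S | y ∈? rs S
      ... | yes _ | yes _ = i₂ x y
      ... | yes _ | no _  = refl
      ... | no _  | _     = refl

    Visible : Config C → Config C → Set
    Visible c c' = (restrict c ≈ restrict c') ⊎ Step S (restrict c) (restrict c')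

    -- Moves of a role p of S between restricted states are steps of S, the
    -- partner lying in S by well-formedness.
    as-send : ∀ {c c' p r a} → p ∈ rs S →
      (restrict-st c p , act p r snd a , restrict-st c' p) ∈ δ (mach S p) →
      (∀ x → x ≢ p → st c' x ≡ st c x) → ch c' p r ≡ ch c p r ++ a ∷ [] →
      (∀ x y → ¬ (x ≡ p × y ≡ r) → ch c' x y ≡ ch c x y) → Step S (restrict c) (restrict c')
    as-send {c} {c'} {p} {r} {a} p∈ t fr chp chfr =
      send p∈ t refl (λ x x≢p → restrict-st-≡ c' c x (λ _ → fr x x≢p)) channel
        (λ x y n → restrict-ch-≡ c' c x y (λ _ _ → chfr x y n))
      where
      r∈ : r ∈ rs S
      r∈ = proj₂ (wf p p∈ t)
      channel : restrict-ch c' p r ≡ restrict-ch c p r ++ a ∷ []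
      channel = trans (restrict-ch-in c' p r p∈ r∈)
        (trans chp (cong (_++ a ∷ []) (sym (restrict-ch-in c p r p∈ r∈))))

    as-recv : ∀ {c c' s p a} → p ∈ rs S →
      (restrict-st c p , act s p rcv a , restrict-st c' p) ∈ δ (mach S p) →
      (∀ x → x ≢ p → st c' x ≡ st c x) → ch c s p ≡ a ∷ ch c' s p →
      (∀ x y → ¬ (x ≡ s × y ≡ p) → ch c' x y ≡ ch c x y) → Step S (restrict c) (restrict c')
    as-recv {c} {c'} {s} {p} {a} p∈ t fr chp chfr =
      recv p∈ t refl (λ x x≢p → restrict-st-≡ c' c x (λ _ → fr x x≢p)) channel
        (λ x y n → restrict-ch-≡ c' c x y (λ _ _ → chfr x y n))
      where
      s∈ : s ∈ rs S
      s∈ = proj₁ (wf p p∈ t)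
      channel : restrict-ch c s p ≡ a ∷ restrict-ch c' s p
      channel = trans (restrict-ch-in c s p s∈ p∈)
        (trans chp (cong (a ∷_) (sym (restrict-ch-in c' s p s∈ p∈))))

    via-G : ∀ {c c' i q l q'} → lookup (δ (mach S G)) i ≡ (q , l , q') →
      restrict-st c G ≡ q → restrict-st c' G ≡ q' →
      (restrict-st c G , l , restrict-st c' G) ∈ δ (mach S G)
    via-G e refl refl = lookup∈ e

    restrict-G≡ : ∀ {c s q} → s ≡ gateway-state c → underlying s ≡ q → restrict-st c G ≡ q
    restrict-G≡ {c} refl e = trans (restrict-G c) e

    gateway-send : ∀ {c c' r a s s'} → GwStep s (act G r snd a) s' →
      s ≡ gateway-state c → s' ≡ gateway-state c' →
      (∀ x → x ≢ G → st c' x ≡ st c x) → ch c' G r ≡ ch c G r ++ a ∷ [] →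
      (∀ x y → ¬ (x ≡ G × y ≡ r) → ch c' x y ≡ ch c x y) → Visible c c'
    gateway-send (send-out i {q' = q'} e) es es' fr chp chfr =
      inj₂ (as-send G∈ (via-G e (restrict-G≡ es (underlying-fresh e))
                                (restrict-G≡ es' (underlying-emb q'))) fr chp chfr)
    gateway-send {c} {c'} (recv-out i {q' = q'} e) es es' fr chp chfr =
      inj₁ (invisible c c' (λ p _ p≢G → sym (fr p p≢G))
              (trans (cong underlying (sym es)) (trans (underlying-fresh e)
                (trans (sym (underlying-emb q')) (cong underlying es'))))
              (λ x y _ y∈ → sym (chfr x y (λ (_ , y≡O) → O∉ (subst (_∈ rs S) y≡O y∈)))))

    gateway-recv : ∀ {c c' x a s s'} → GwStep s (act x G rcv a) s' →
      s ≡ gateway-state c → s' ≡ gateway-state c' →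
      (∀ p → p ≢ G → st c' p ≡ st c p) → ch c x G ≡ a ∷ ch c' x G →
      (∀ u v → ¬ (u ≡ x × v ≡ G) → ch c' u v ≡ ch c u v) → Visible c c'
    gateway-recv {c} {c'} (send-in i {q} e) es es' fr chp chfr =
      inj₁ (invisible c c' (λ p _ p≢G → sym (fr p p≢G))
              (trans (cong underlying (sym es)) (trans (underlying-emb q)
                (trans (sym (underlying-fresh e)) (cong underlying es'))))
              (λ u v u∈ _ → sym (chfr u v (λ (u≡O , _) → O∉ (subst (_∈ rs S) u≡O u∈)))))
    gateway-recv (recv-in i {q} e) es es' fr chp chfr =
      inj₂ (as-recv G∈ (via-G e (restrict-G≡ es (underlying-emb q))
                                (restrict-G≡ es' (underlying-fresh e))) fr chp chfr)

    other-δ : ∀ {c c' p l q'} (p∈ : p ∈ rs S) (p≢G : p ≢ G) → (st c p , l , q') ∈ δ (mach C p) →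
      st c' p ≡ q' → (restrict-st c p , l , restrict-st c' p) ∈ δ (mach S p)
    other-δ {c} {c'} {p} {l} p∈ p≢G t refl =
      subst₂ (λ u v → (u , l , v) ∈ δ (mach S p))
        (sym (restrict-other c p p∈ p≢G)) (sym (restrict-other c' p p∈ p≢G))
        (cast-δ (eq-other p p∈ p≢G) t)

    outside : ∀ {c c' p} → p ∉ rs S → (∀ x → x ≢ p → st c' x ≡ st c x) →
      (∀ x y → x ∈ rs S → y ∈ rs S → ch c' x y ≡ ch c x y) → restrict c ≈ restrict c'
    outside {c} {c'} {p} p∉ fr fr-ch =
      invisible c c' (λ x x∈ _ → sym (fr x (≢p x∈))) (cong (λ s → underlying (cast eq-G s)) (sym (fr G (≢p G∈))))
        (λ x y x∈ y∈ → sym (fr-ch x y x∈ y∈))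
      where
      ≢p : ∀ {x} → x ∈ rs S → x ≢ p
      ≢p x∈ x≡p = p∉ (subst (_∈ rs S) x≡p x∈)

    restrict-step : ∀ {c c'} → Step C c c' → Visible c c'
    restrict-step (send {p} {r} {a} p∈C t stp fr chp chfr) with p ∈? rs S
    ... | no p∉ = inj₁ (outside p∉ fr (λ x y x∈ _ → chfr x y (λ (x≡p , _) → p∉ (subst (_∈ rs S) x≡p x∈))))
    ... | yes p∈ with p ≟ G
    ...   | yes refl = gateway-send (gw-inv (cast-δ eq-G t)) refl (cong (cast eq-G) (sym stp)) fr chp chfr
    ...   | no p≢G = inj₂ (as-send p∈ (other-δ p∈ p≢G t stp) fr chp chfr)
    restrict-step (recv {s} {p} {a} p∈C t stp fr chp chfr) with p ∈? rs S
    ... | no p∉ = inj₁ (outside p∉ fr (λ x y _ y∈ → chfr x y (λ (_ , y≡p) → p∉ (subst (_∈ rs S) y≡p y∈))))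
    ... | yes p∈ with p ≟ G
    ...   | yes refl = gateway-recv (gw-inv (cast-δ eq-G t)) refl (cong (cast eq-G) (sym stp)) fr chp chfr
    ...   | no p≢G = inj₂ (as-recv p∈ (other-δ p∈ p≢G t stp) fr chp chfr)

    restrict-reachable : ∀ {c} → Reachable C c → Reachable S (restrict c)
    restrict-reachable = reachable-ind (λ c → Reachable S (restrict c))
      (λ ini → _ , restrict-initial ini , ε) next
      where
      next : ∀ {c c'} → Reachable C c → Step C c c' → Reachable S (restrict c) → Reachable S (restrict c')
      next _ s r with restrict-step s
      ... | inj₁ same = reachable-≈ r same
      ... | inj₂ step = reachable-step r step

  -- The invariant linking the gateways of compatible machines mA, mB: the
  -- underlying states satisfy SyncInv, the queue towards B consisting of
  -- B's pending input, the channel AB and A's pending output (and dually).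
  module GatewayPair (mA mB : M) (A B : Role) where
    module GA = Gateway mA A B
    module GB = Gateway mB B A

    Joint : GA.Summary → GB.Summary → List Msg → List Msg → Set
    Joint (a , inA , outA) (b , inB , outB) chAB chBA =
      SyncInv mA mB a b (inB ++ chAB ++ outA) (inA ++ chBA ++ outB)

    PairInv : State GA.g → State GB.g → List Msg → List Msg → Set
    PairInv sA sB = Joint (GA.summary sA) (GB.summary sB)

    pairinv-cong : ∀ {sA sA' sB sB' chAB chAB' chBA chBA'} → sA ≡ sA' → sB ≡ sB' →
      chAB ≡ chAB' → chBA ≡ chBA' → PairInv sA sB chAB chBA → PairInv sA' sB' chAB' chBA'
    pairinv-cong refl refl refl refl inv = inv

    pairinv-init : PairInv (init GA.g) (init GB.g) [] []
    pairinv-init rewrite GA.summary-emb (init mA) | GB.summary-emb (init mB) = syncinv-init mA mB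

    pairinv-at-rest : ∀ {q k chAB chBA} → PairInv (GA.emb q) (GB.emb k) chAB chBA →
      SyncInv mA mB q k chAB chBA
    pairinv-at-rest {q} {k} {chAB} {chBA} inv
      rewrite GA.summary-emb q | GB.summary-emb k | ++-identityʳ chAB | ++-identityʳ chBA = inv

    pairinv-pending : ∀ {q sB chAB c chBA} → Compat mA mB → PairInv (GA.emb q) sB chAB (c ∷ chBA) →
      ∃₂ λ x y → ∃ λ q' → (q , act x y snd c , q') ∈ δ mA
    pairinv-pending {q} cm inv rewrite GA.summary-emb q = syncinv-pending cm inv

    module Moves (cm : Compat mA mB) {sB : State GB.g} {chAB chBA : List Msg} where

      move-send-out : ∀ {i q x y a q'} → lookup (δ mA) i ≡ (q , act x y snd a , q') →
        PairInv (GA.fresh i) sB chAB chBA → PairInv (GA.emb q') sB chAB chBA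
      move-send-out {q' = q'} e inv rewrite GA.summary-fresh e | GA.summary-emb q' =
        syncinv-send inv (GA.lookup∈ e) refl

      -- accepting a message from B only moves it from the channel into the gateway
      move-send-in : ∀ {i q x y a q'} → lookup (δ mA) i ≡ (q , act x y snd a , q') →
        PairInv (GA.emb q) sB chAB (a ∷ chBA) → PairInv (GA.fresh i) sB chAB chBA
      move-send-in {q = q} e inv rewrite GA.summary-fresh e | GA.summary-emb q = inv

      move-recv-in : ∀ {i q x y a q'} → lookup (δ mA) i ≡ (q , act x y rcv a , q') →
        PairInv (GA.emb q) sB chAB chBA → PairInv (GA.fresh i) sB chAB chBA
      move-recv-in {q = q} {a = a} e inv rewrite GA.summary-fresh e | GA.summary-emb q =
        subst (λ qAB → SyncInv mA mB _ _ qAB _) (reassoc (GB.summary sB))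
          (syncinv-receive cm inv (GA.lookup∈ e))
        where
        reassoc : (sum : GB.Summary) → (proj₁ (proj₂ sum) ++ chAB ++ []) ++ a ∷ [] ≡
                                        proj₁ (proj₂ sum) ++ chAB ++ a ∷ []
        reassoc (_ , inB , _) rewrite ++-identityʳ chAB = ++-assoc inB chAB (a ∷ [])

      -- forwarding a reception to B only moves it from the gateway into the channel
      move-recv-out : ∀ {i q x y a q'} → lookup (δ mA) i ≡ (q , act x y rcv a , q') →
        PairInv (GA.fresh i) sB chAB chBA → PairInv (GA.emb q') sB (chAB ++ a ∷ []) chBA
      move-recv-out {a = a} {q' = q'} e inv rewrite GA.summary-fresh e | GA.summary-emb q'
        | ++-identityʳ (chAB ++ a ∷ []) = inv

  pairinv-sym : ∀ {mA mB A B sA sB chAB chBA} → GatewayPair.PairInv mA mB A B sA sB chAB chBA →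
    GatewayPair.PairInv mB mA B A sB sA chBA chAB
  pairinv-sym = syncinv-sym

  mover : ∀ {S c c'} → Step S c c' → Role
  mover (send {p} _ _ _ _ _ _) = p
  mover (recv {_} {p} _ _ _ _ _ _) = p

  -- The pair invariant for two gateways A, B inside a system C: preserved by
  -- the moves of A (whose machine never addresses B) and of third roles.
  module PairInSystem (C : System) (A B : Role) (mA mB : M)
    (eq-A : mach C A ≡ gw mA A B) (eq-B : mach C B ≡ gw mB B A) (A≢B : A ≢ B)
    (cm : Compat mA mB) (avoids-B : ∀ {q l q'} → (q , l , q') ∈ δ mA → Act.from l ≢ B × Act.to l ≢ B)
    where
    open GatewayPair mA mB A B
    open Moves cm

    Inv : Config C → Set
    Inv c = PairInv (cast eq-A (st c A)) (cast eq-B (st c B)) (ch c A B) (ch c B A)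

    inv-initial : ∀ {c} → Initial C c → Inv c
    inv-initial (i₁ , i₂) = pairinv-cong
      (sym (trans (cong (cast eq-A) (i₁ A)) (cast-init eq-A)))
      (sym (trans (cong (cast eq-B) (i₁ B)) (cast-init eq-B)))
      (sym (i₂ A B)) (sym (i₂ B A)) pairinv-init

    B≢A : B ≢ A
    B≢A e = A≢B (sym e)

    step-A : ∀ {c c'} (s : Step C c c') → mover s ≡ A → Inv c → Inv c'
    step-A {c} {c'} (send {r = r} {a} _ t stp fr chp chfr) refl inv =
      by (GA.gw-inv (cast-δ eq-A t)) refl (cong (cast eq-A) (sym stp))
      where
      same-B : cast eq-B (st c B) ≡ cast eq-B (st c' B)
      same-B = cong (cast eq-B) (sym (fr B B≢A))
      same-BA : ch c B A ≡ ch c' B A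
      same-BA = sym (chfr B A (λ (B≡A , _) → B≢A B≡A))
      by : ∀ {s s'} → GA.GwStep s (act A r snd a) s' → s ≡ cast eq-A (st c A) → s' ≡ cast eq-A (st c' A) → Inv c'
      by (GA.send-out i e) es es' = pairinv-cong es' same-B
        (sym (chfr A B (λ (_ , B≡r) → proj₂ (avoids-B (GA.lookup∈ e)) (sym B≡r)))) same-BA
        (move-send-out e (pairinv-cong (sym es) refl refl refl inv))
      by (GA.recv-out i e) es es' = pairinv-cong es' same-B (sym chp) same-BA
        (move-recv-out e (pairinv-cong (sym es) refl refl refl inv))
    step-A {c} {c'} (recv {s = x} {a = a} _ t stp fr chp chfr) refl inv =
      by (GA.gw-inv (cast-δ eq-A t)) refl (cong (cast eq-A) (sym stp))
      where
      same-B : cast eq-B (st c B) ≡ cast eq-B (st c' B)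
      same-B = cong (cast eq-B) (sym (fr B B≢A))
      same-AB : ch c A B ≡ ch c' A B
      same-AB = sym (chfr A B (λ (_ , B≡A) → B≢A B≡A))
      by : ∀ {s s'} → GA.GwStep s (act x A rcv a) s' → s ≡ cast eq-A (st c A) → s' ≡ cast eq-A (st c' A) → Inv c'
      by (GA.send-in i e) es es' = pairinv-cong es' same-B same-AB refl
        (move-send-in e (pairinv-cong (sym es) refl refl chp inv))
      by (GA.recv-in i e) es es' = pairinv-cong es' same-B same-AB
        (sym (chfr B A (λ (B≡x , _) → proj₁ (avoids-B (GA.lookup∈ e)) (sym B≡x))))
        (move-recv-in e (pairinv-cong (sym es) refl refl refl inv))

    step-other : ∀ {c c'} (s : Step C c c') → mover s ≢ A → mover s ≢ B → Inv c → Inv c'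
    step-other {c} {c'} (send _ _ _ fr _ chfr) ≢A ≢B = pairinv-cong
      (cong (cast eq-A) (sym (fr A (λ e → ≢A (sym e))))) (cong (cast eq-B) (sym (fr B (λ e → ≢B (sym e)))))
      (sym (chfr A B (λ (e , _) → ≢A (sym e)))) (sym (chfr B A (λ (e , _) → ≢B (sym e))))
    step-other {c} {c'} (recv _ _ _ fr _ chfr) ≢A ≢B = pairinv-cong
      (cong (cast eq-A) (sym (fr A (λ e → ≢A (sym e))))) (cong (cast eq-B) (sym (fr B (λ e → ≢B (sym e)))))
      (sym (chfr A B (λ (_ , e) → ≢B (sym e)))) (sym (chfr B A (λ (_ , e) → ≢A (sym e))))

  module Side (C S : System) (G O : Role) (mO : M) (G∈ : G ∈ rs S) (O∉ : O ∉ rs S)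
    (G∈C : G ∈ rs C) (O∈C : O ∈ rs C) (S⊆C : ∀ {p} → p ∈ rs S → p ∈ rs C)
    (eq-other : ∀ p → p ∈ rs S → p ≢ G → mach C p ≡ mach S p)
    (eq-G : mach C G ≡ gw (mach S G) G O) (eq-O : mach C O ≡ gw mO O G)
    (wf : WellFormed S) (safe : Safe S) (cm : Compat (mach S G) mO)
    (inv : ∀ {c} → Reachable C c → GatewayPair.PairInv (mach S G) mO G O
             (cast eq-G (st c G)) (cast eq-O (st c O)) (ch c G O) (ch c O G)) where

    mG : M
    mG = mach S G

    open Restriction C S G O G∈ O∉ eq-other eq-G wf
    open GatewayPair mG mO G O using (pairinv-at-rest; pairinv-pending; pairinv-cong)
    module GG = Gateway mG G O
    module GO = Gateway mO O G

    partner-state : Config C → State GO.g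
    partner-state c = cast eq-O (st c O)

    restrict-G-emb : ∀ {c q} → gateway-state c ≡ GG.emb q → restrict-st c G ≡ q
    restrict-G-emb eG = restrict-G≡ (sym eG) (GG.underlying-emb _)

    in-C : ∀ {c q l s'} → gateway-state c ≡ GG.emb q → (GG.emb q , l , s') ∈ δ GG.g →
      ∃ λ s'' → (st c G , l , s'') ∈ δ (mach C G)
    in-C eG t = _ , cast-δ⁻ eq-G (subst (λ u → (u , _ , _) ∈ δ GG.g) (sym eG) t)

    at-rest : ∀ {c q k} → Reachable C c → gateway-state c ≡ GG.emb q → partner-state c ≡ GO.emb k →
      SyncInv mG mO q k (ch c G O) (ch c O G)
    at-rest r eG eO = pairinv-at-rest (pairinv-cong eG eO refl refl (inv r))

    receiving-other : ∀ {c p} (p∈ : p ∈ rs S) (p≢G : p ≢ G) → Receiving (mach C p) (st c p) →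
      Receiving (mach S p) (restrict-st c p)
    receiving-other {c} {p} p∈ p≢G r = subst (Receiving (mach S p)) (sym (restrict-other c p p∈ p≢G))
      (cast-receiving (eq-other p p∈ p≢G) r)

    receiving-G : ∀ {c q} → gateway-state c ≡ GG.emb q → Receiving (mach C G) (st c G) →
      ¬ HasSend mG q → Receiving mG (restrict-st c G)
    receiving-G eG r ns = subst (Receiving mG) (sym (restrict-G-emb eG))
      (GG.receiving-unlift (subst (Receiving GG.g) eG (cast-receiving eq-G r)) ns)

    AllFinal : Config C → Set
    AllFinal c = ∀ p → p ∈ rs C → Final (mach C p) (st c p)

    gateway-final : ∀ {c} → AllFinal c → ∃ λ q → gateway-state c ≡ GG.emb q × Final mG q
    gateway-final {c} fin with GG.final-emb (cast-final eq-G (fin G G∈C))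
    ... | q , eG = q , eG , GG.final-unlift (subst (Final GG.g) eG (cast-final eq-G (fin G G∈C)))

    partner-final : ∀ {c} → AllFinal c → ∃ λ k → partner-state c ≡ GO.emb k × Final mO k
    partner-final {c} fin with GO.final-emb (cast-final eq-O (fin O O∈C))
    ... | k , eO = k , eO , GO.final-unlift (subst (Final GO.g) eO (cast-final eq-O (fin O O∈C)))

    restrict-final : ∀ {c} → AllFinal c → ∀ p → p ∈ rs S → Final (mach S p) (restrict-st c p)
    restrict-final {c} fin p p∈ with p ≟ G
    ... | yes refl = let _ , eG , finG = gateway-final {c} fin in subst (Final mG) (sym (restrict-G-emb {c} eG)) finG
    ... | no p≢G = subst (Final (mach S p)) (sym (restrict-other c p p∈ p≢G))
                     (cast-final (eq-other p p∈ p≢G) (fin p (S⊆C p∈)))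

    -- Deadlock: if mG cannot send, the restriction is a deadlock of S; if it
    -- can, the partner (synchronised, channels being empty) has a matching
    -- reception, so mO cannot send.
    no-deadlock-quiet : ∀ {c q} → Reachable C c → Deadlock C c → gateway-state c ≡ GG.emb q →
      ¬ HasSend mG q → ⊥
    no-deadlock-quiet {c} r (empty , receiving) eG ns =
      proj₁ (safe (restrict c) (restrict-reachable r)) (empty-S , receiving-S)
      where
      empty-S : ∀ x y → x ∈ rs S → y ∈ rs S → restrict-ch c x y ≡ []
      empty-S x y x∈ y∈ = trans (restrict-ch-in c x y x∈ y∈) (empty x y (S⊆C x∈) (S⊆C y∈))
      receiving-S : ∀ p → p ∈ rs S → Receiving (mach S p) (restrict-st c p)
      receiving-S p p∈ with p ≟ G
      ... | yes refl = receiving-G eG (receiving G G∈C) ns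
      ... | no p≢G = receiving-other p∈ p≢G (receiving p (S⊆C p∈))

    deadlock-partner-quiet : ∀ {c q k} → Reachable C c → Deadlock C c → gateway-state c ≡ GG.emb q →
      partner-state c ≡ GO.emb k → HasSend mG q → ¬ HasSend mO k
    deadlock-partner-quiet {c} {q} {k} r (empty , _) eG eO (l , _ , t , d) (_ , _ , tO , dO)
      with compat-answer cm (syncinv-empty (subst₂ (SyncInv mG mO q k)
             (empty G O G∈C O∈C) (empty O G O∈C G∈C) (at-rest r eG eO))) t
    ... | lO , _ , t' , e , _ = not-mixed {mO} (no-mixedB cm) tO t' dO (dualE-snd {lO} (trans e (erase-snd {l} d)))

    -- Orphans: a message inside S is an orphan of the restriction; a message
    -- towards O contradicts the invariant, O being final.
    no-orphan-inside : ∀ {c x y} → Reachable C c → AllFinal c → x ∈ rs S → y ∈ rs S → ch c x y ≢ [] → ⊥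
    no-orphan-inside {c} {x} {y} r fin x∈ y∈ ne = proj₁ (proj₂ (safe (restrict c) (restrict-reachable r)))
      (restrict-final fin , x , y , x∈ , y∈ , (λ e → ne (trans (sym (restrict-ch-in c x y x∈ y∈)) e)))

    no-orphan-outgoing : ∀ {c} → Reachable C c → AllFinal c → ch c G O ≢ [] → ⊥
    no-orphan-outgoing {c} r fin ne =
      let _ , eG , _ = gateway-final {c} fin ; _ , eO , finO = partner-final {c} fin
      in ne (syncinv-final cm (at-rest r eG eO) finO)

    no-orphan : ∀ {c x y q a q'} → Reachable C c → AllFinal c → x ∈ rs S → ch c x y ≢ [] →
      (q , act x y snd a , q') ∈ δ (mach C x) → ⊥
    no-orphan {c} {x} {y} r fin x∈ ne t with x ≟ G
    ... | no x≢G = no-orphan-inside r fin x∈ (proj₂ (wf x x∈ (cast-δ (eq-other x x∈ x≢G) t))) ne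
    ... | yes refl = by (GG.gw-inv (cast-δ eq-G t)) ne
      where
      by : ∀ {y a s s'} → GG.GwStep s (act G y snd a) s' → ch c G y ≢ [] → ⊥
      by (GG.send-out i e) ne = no-orphan-inside r fin G∈ (proj₂ (wf G G∈ (GG.lookup∈ e))) ne
      by (GG.recv-out i e) ne = no-orphan-outgoing r fin ne

    -- Unspecified receptions: at a role of S other than G, or at G when mG
    -- cannot send, the restriction is an unspecified reception of S.  When
    -- mG can send, the gateway also accepts from O, so O has put a message
    -- on the channel; by the invariant mG can send that very message, and
    -- the gateway accepts it, a contradiction.
    Unexpected : Config C → Role → Set
    Unexpected c r₀ = ∀ s a q' → (st c r₀ , act s r₀ rcv a , q') ∈ δ (mach C r₀) →
      ∃₂ λ b bs → ch c s r₀ ≡ b ∷ bs × b ≢ a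

    no-unspecified : ∀ {c r₀} → Reachable C c → r₀ ∈ rs S → Receiving (mach C r₀) (st c r₀) →
      Unexpected c r₀ → ⊥
    no-unspecified {c} {r₀} r r∈ rec hyp with r₀ ≟ G
    ... | no r≢G = proj₂ (proj₂ (safe (restrict c) (restrict-reachable r))) (r₀ , r∈ , receiving-other r∈ r≢G rec , hyp-S)
      where
      e : mach C r₀ ≡ mach S r₀
      e = eq-other r₀ r∈ r≢G
      hyp-S : ∀ s a q' → (restrict-st c r₀ , act s r₀ rcv a , q') ∈ δ (mach S r₀) →
        ∃₂ λ b bs → restrict-ch c s r₀ ≡ b ∷ bs × b ≢ a
      hyp-S s a q' t with hyp s a _ (cast-δ⁻ e (subst (λ u → (u , act s r₀ rcv a , q') ∈ δ (mach S r₀))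
                                                  (restrict-other c r₀ r∈ r≢G) t))
      ... | b , bs , eq , b≢a = b , bs , trans (restrict-ch-in c s r₀ (proj₁ (wf r₀ r∈ t)) r∈) eq , b≢a
    ... | yes refl with GG.receiving-emb (cast-receiving eq-G rec)
    ...   | q₀ , eG with has-send? mG q₀
    ...     | no ns = proj₂ (proj₂ (safe (restrict c) (restrict-reachable r))) (G , G∈ , receiving-G eG rec ns , hyp-S)
      where
      hyp-S : ∀ s a q' → (restrict-st c G , act s G rcv a , q') ∈ δ mG →
        ∃₂ λ b bs → restrict-ch c s G ≡ b ∷ bs × b ≢ a
      hyp-S s a q' t with hyp s a _ (proj₂ (in-C {c} eG (proj₂ (GG.lift-recv
                             (subst (λ u → (u , act s G rcv a , q') ∈ δ mG) (restrict-G-emb eG) t)))))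
      ... | b , bs , eq , b≢a = b , bs , trans (restrict-ch-in c s G (proj₁ (wf G G∈ t)) G∈) eq , b≢a
    ...     | yes (act _ _ snd b₀ , _ , t₀ , _)
      with hyp O b₀ _ (proj₂ (in-C {c} eG (proj₂ (GG.lift-send t₀))))
    ...       | b , bs , chOG , _
      with pairinv-pending cm (pairinv-cong eG refl refl chOG (inv r))
    ...         | _ , _ , _ , t
      with hyp O b _ (proj₂ (in-C {c} eG (proj₂ (GG.lift-send t))))
    ...           | b' , _ , chOG' , b'≢b = b'≢b (∷-injectiveˡ (trans (sym chOG') chOG))

  module Composition (S₁ S₂ : System) (H K : Role) (H∈ : H ∈ rs S₁) (K∈ : K ∈ rs S₂)
    (disjoint : ∀ {p} → p ∈ rs S₁ → p ∈ rs S₂ → ⊥) where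

    C : System
    C = compose S₁ H K S₂

    mH mK : M
    mH = mach S₁ H
    mK = mach S₂ K

    module GH = Gateway mH H K
    module GK = Gateway mK K H

    H≢K : H ≢ K
    H≢K refl = disjoint H∈ K∈

    K≢H : K ≢ H
    K≢H e = H≢K (sym e)

    K∉₁ : K ∉ rs S₁
    K∉₁ K∈₁ = disjoint K∈₁ K∈

    H∉₂ : H ∉ rs S₂
    H∉₂ H∈₂ = disjoint H∈ H∈₂

    sub₁ : ∀ {p} → p ∈ rs S₁ → p ∈ rs C
    sub₁ = ∈-++⁺ˡ

    sub₂ : ∀ {p} → p ∈ rs S₂ → p ∈ rs C
    sub₂ = ∈-++⁺ʳ (rs S₁)

    eq-H : mach C H ≡ gw mH H K
    eq-H with H ≟ H
    ... | yes _ = refl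
    ... | no H≢H = ⊥-elim (H≢H refl)

    eq-K : mach C K ≡ gw mK K H
    eq-K with K ≟ H
    ... | yes K≡H = ⊥-elim (K≢H K≡H)
    ... | no _ with K ≟ K
    ...   | yes _ = refl
    ...   | no K≢K = ⊥-elim (K≢K refl)

    eq₁ : ∀ p → p ∈ rs S₁ → p ≢ H → mach C p ≡ mach S₁ p
    eq₁ p p∈ p≢H with p ≟ H
    ... | yes p≡H = ⊥-elim (p≢H p≡H)
    ... | no _ with p ≟ K
    ...   | yes refl = ⊥-elim (K∉₁ p∈)
    ...   | no _ with p ∈? rs S₁
    ...     | yes _ = refl
    ...     | no p∉ = ⊥-elim (p∉ p∈)

    eq₂ : ∀ p → p ∈ rs S₂ → p ≢ K → mach C p ≡ mach S₂ p
    eq₂ p p∈ p≢K with p ≟ H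
    ... | yes refl = ⊥-elim (H∉₂ p∈)
    ... | no _ with p ≟ K
    ...   | yes p≡K = ⊥-elim (p≢K p≡K)
    ...   | no _ with p ∈? rs S₁
    ...     | yes p∈₁ = ⊥-elim (disjoint p∈₁ p∈)
    ...     | no _ = refl

    Talks : Role → Set
    Talks p = ∀ {q l q'} → (q , l , q') ∈ δ (mach C p) → Act.from l ∈ rs C × Act.to l ∈ rs C

    talks₁ : WellFormed S₁ → ∀ p → p ∈ rs S₁ → Dec (p ≡ H) → Talks p
    talks₁ wf₁ p p∈ (yes refl) t = GH.gw-talks-within (_∈ rs C) (sub₁ H∈) (sub₂ K∈)
      (λ t' → let f , t = wf₁ H H∈ t' in sub₁ f , sub₁ t) (cast-δ eq-H t)
    talks₁ wf₁ p p∈ (no p≢H) t = let f , t' = wf₁ p p∈ (cast-δ (eq₁ p p∈ p≢H) t) in sub₁ f , sub₁ t'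

    talks₂ : WellFormed S₂ → ∀ p → p ∈ rs S₂ → Dec (p ≡ K) → Talks p
    talks₂ wf₂ p p∈ (yes refl) t = GK.gw-talks-within (_∈ rs C) (sub₂ K∈) (sub₁ H∈)
      (λ t' → let f , t = wf₂ K K∈ t' in sub₂ f , sub₂ t) (cast-δ eq-K t)
    talks₂ wf₂ p p∈ (no p≢K) t = let f , t' = wf₂ p p∈ (cast-δ (eq₂ p p∈ p≢K) t) in sub₂ f , sub₂ t'

    compose-wellformed : WellFormed S₁ → WellFormed S₂ → WellFormed C
    compose-wellformed wf₁ wf₂ p p∈ with ∈-++⁻ (rs S₁) p∈
    ... | inj₁ p∈₁ = talks₁ wf₁ p p∈₁ (p ≟ H)
    ... | inj₂ p∈₂ = talks₂ wf₂ p p∈₂ (p ≟ K)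

    avoids : ∀ {S X Y} → WellFormed S → X ∈ rs S → Y ∉ rs S →
      ∀ {q l q'} → (q , l , q') ∈ δ (mach S X) → Act.from l ≢ Y × Act.to l ≢ Y
    avoids {S} wf X∈ Y∉ t = let f , t' = wf _ X∈ t in
      (λ e → Y∉ (subst (_∈ rs S) e f)) , (λ e → Y∉ (subst (_∈ rs S) e t'))

    compose-safe : WellFormed S₁ → WellFormed S₂ → Compat mH mK → Safe S₁ → Safe S₂ → Safe C
    compose-safe wf₁ wf₂ cm safe₁ safe₂ c r = no-deadlock , no-orphan , no-unspecified
      where
      module Pair₁ = PairInSystem C H K mH mK eq-H eq-K H≢K cm (avoids {S₁} wf₁ H∈ K∉₁)
      module Pair₂ = PairInSystem C K H mK mH eq-K eq-H K≢H (compat-sym cm) (avoids {S₂} wf₂ K∈ H∉₂)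

      invariant : ∀ {c} → Reachable C c → Pair₁.Inv c
      invariant = reachable-ind Pair₁.Inv Pair₁.inv-initial step
        where
        step : ∀ {c c'} → Reachable C c → Step C c c' → Pair₁.Inv c → Pair₁.Inv c'
        step _ s inv with mover s ≟ H
        ... | yes e = Pair₁.step-A s e inv
        ... | no ≢H with mover s ≟ K
        ...   | yes e = pairinv-sym {mK} {mH} {K} {H} (Pair₂.step-A s e (pairinv-sym {mH} {mK} {H} {K} inv))
        ...   | no ≢K = Pair₁.step-other s ≢H ≢K inv

      module Side₁ = Side C S₁ H K mK H∈ K∉₁ (sub₁ H∈) (sub₂ K∈) sub₁ eq₁ eq-H eq-K wf₁ safe₁ cm invariant
      module Side₂ = Side C S₂ K H mH K∈ H∉₂ (sub₂ K∈) (sub₁ H∈) sub₂ eq₂ eq-K eq-H wf₂ safe₂ (compat-sym cm)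
                       (λ r → pairinv-sym {mH} {mK} {H} {K} (invariant r))

      -- both gateways rest; if mH can send, mK cannot
      no-deadlock : ¬ Deadlock C c
      no-deadlock dl with GH.receiving-emb (cast-receiving eq-H (proj₂ dl H (sub₁ H∈)))
                        | GK.receiving-emb (cast-receiving eq-K (proj₂ dl K (sub₂ K∈)))
      ... | q , eH | k , eK with has-send? mH q
      ...   | no quiet = Side₁.no-deadlock-quiet r dl eH quiet
      ...   | yes sends = Side₂.no-deadlock-quiet r dl eK (Side₁.deadlock-partner-quiet r dl eH eK sends)

      no-orphan : ¬ Orphan C c
      no-orphan (fin , x , y , x∈ , _ , ne) with nonempty-sender r x y ne
      ... | _ , _ , _ , _ , t with ∈-++⁻ (rs S₁) x∈
      ...   | inj₁ x∈₁ = Side₁.no-orphan r fin x∈₁ ne t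
      ...   | inj₂ x∈₂ = Side₂.no-orphan r fin x∈₂ ne t

      no-unspecified : ¬ UnspecifiedReception C c
      no-unspecified (r₀ , r∈ , rec , hyp) with ∈-++⁻ (rs S₁) r∈
      ... | inj₁ r∈₁ = Side₁.no-unspecified r r∈₁ rec hyp
      ... | inj₂ r∈₂ = Side₂.no-unspecified r r∈₂ rec hyp

  roles-sem : ∀ t → rs (sem t) ≡ rolesT t
  roles-sem (base G I) = refl
  roles-sem (comp t₁ H K t₂) = cong₂ _++_ (roles-sem t₁) (roles-sem t₂)

  to-sem : ∀ t {p} → p ∈ rolesT t → p ∈ rs (sem t)
  to-sem t = subst (_ ∈_) (sym (roles-sem t))

  from-sem : ∀ t {p} → p ∈ rs (sem t) → p ∈ rolesT t
  from-sem t = subst (_ ∈_) (roles-sem t)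

  iface-comp : ∀ {t₁ H K t₂ p} → p ∈ iface (comp t₁ H K t₂) →
    (p ∈ iface t₁ ⊎ p ∈ iface t₂) × p ≢ H × p ≢ K
  iface-comp {t₁} {H} {K} {t₂} p∈ with ∈-filter⁻ (λ p → ¬? (p ≟ H) ×-dec ¬? (p ≟ K)) {xs = iface t₁ ++ iface t₂} p∈
  ... | p∈' , p≢H , p≢K = ∈-++⁻ (iface t₁) p∈' , p≢H , p≢K

  iface⊆roles : ∀ t → IsGTIR t → ∀ {p} → p ∈ iface t → p ∈ rolesT t
  iface⊆roles (base G I) (I⊆ , _) p∈ = I⊆ p∈
  iface⊆roles (comp t₁ H K t₂) (g₁ , g₂ , _) p∈ with iface-comp {t₁} {H} {K} {t₂} p∈
  ... | inj₁ p∈₁ , _ = ∈-++⁺ˡ (iface⊆roles t₁ g₁ p∈₁)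
  ... | inj₂ p∈₂ , _ = ∈-++⁺ʳ (rolesT t₁) (iface⊆roles t₂ g₂ p∈₂)

  projT-left : ∀ {t₁ H K t₂ p} → p ∈ rolesT t₁ → projT (comp t₁ H K t₂) p ≡ projT t₁ p
  projT-left {t₁} {p = p} p∈ with p ∈? rolesT t₁
  ... | yes _ = refl
  ... | no p∉ = ⊥-elim (p∉ p∈)

  projT-right : ∀ {t₁ H K t₂ p} → p ∉ rolesT t₁ → projT (comp t₁ H K t₂) p ≡ projT t₂ p
  projT-right {t₁} {p = p} p∉ with p ∈? rolesT t₁
  ... | yes p∈ = ⊥-elim (p∉ p∈)
  ... | no _ = refl

  module Junction {t₁ H K t₂} (g : IsGTIR (comp t₁ H K t₂)) where
    H∈ : H ∈ rs (sem t₁)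
    H∈ = to-sem t₁ (iface⊆roles t₁ (proj₁ g) (proj₁ (proj₂ (proj₂ (proj₂ g)))))

    K∈ : K ∈ rs (sem t₂)
    K∈ = to-sem t₂ (iface⊆roles t₂ (proj₁ (proj₂ g)) (proj₁ (proj₂ (proj₂ (proj₂ (proj₂ g))))))

    disjoint : ∀ {p} → p ∈ rs (sem t₁) → p ∈ rs (sem t₂) → ⊥
    disjoint p∈₁ p∈₂ = proj₁ (proj₂ (proj₂ g)) _ (from-sem t₁ p∈₁) (from-sem t₂ p∈₂)

    open Composition (sem t₁) (sem t₂) H K H∈ K∈ disjoint public

  mach-sem : ∀ t → IsGTIR t → ∀ {p} → p ∈ iface t → mach (sem t) p ≡ projT t p
  mach-sem (base G I) _ _ = refl
  mach-sem (comp t₁ H K t₂) g {p} p∈ with iface-comp {t₁} {H} {K} {t₂} p∈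
  ... | inj₁ p∈₁ , p≢H , _ = let p∈r = iface⊆roles t₁ (proj₁ g) p∈₁ in
    trans (J.eq₁ p (to-sem t₁ p∈r) p≢H) (trans (mach-sem t₁ (proj₁ g) p∈₁) (sym (projT-left {t₁} {H} {K} {t₂} p∈r)))
    where module J = Junction {t₁} {H} {K} {t₂} g
  ... | inj₂ p∈₂ , _ , p≢K = let p∈r = iface⊆roles t₂ (proj₁ (proj₂ g)) p∈₂ in
    trans (J.eq₂ p (to-sem t₂ p∈r) p≢K) (trans (mach-sem t₂ (proj₁ (proj₂ g)) p∈₂)
      (sym (projT-right {t₁} {H} {K} {t₂} (λ p∈₁ → proj₁ (proj₂ (proj₂ g)) p p∈₁ p∈r))))
    where module J = Junction {t₁} {H} {K} {t₂} g

  projection-wellformed : ∀ G → WellFormed (baseSys G)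
  projection-wellformed G p p∈ t = let f∈ , t∈ , _ = wf G p p∈ t in f∈ , t∈

  -- Corollary 4, by induction on the GTIR, strengthened by well-formedness
  -- (which the composition theorem needs of its parts).
  gtir-safe : ∀ t → IsGTIR t → (∀ G → G ∈ components t → Safe (baseSys G)) →
    WellFormed (sem t) × Safe (sem t)
  gtir-safe (base G I) _ safe = projection-wellformed G , safe G (here refl)
  gtir-safe (comp t₁ H K t₂) g safe =
    J.compose-wellformed wf₁ wf₂ , J.compose-safe wf₁ wf₂ compat safe₁ safe₂
    where
    module J = Junction {t₁} {H} {K} {t₂} g
    IH₁ = gtir-safe t₁ (proj₁ g) (λ G G∈ → safe G (∈-++⁺ˡ G∈))
    IH₂ = gtir-safe t₂ (proj₁ (proj₂ g)) (λ G G∈ → safe G (∈-++⁺ʳ (components t₁) G∈))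
    wf₁ = proj₁ IH₁
    safe₁ = proj₂ IH₁
    wf₂ = proj₁ IH₂
    safe₂ = proj₂ IH₂
    compat : Compat (mach (sem t₁) H) (mach (sem t₂) K)
    compat = fromCompatible (subst₂ Compatible
      (sym (mach-sem t₁ (proj₁ g) (proj₁ (proj₂ (proj₂ (proj₂ g))))))
      (sym (mach-sem t₂ (proj₁ (proj₂ g)) (proj₁ (proj₂ (proj₂ (proj₂ (proj₂ g)))))))
      (proj₂ (proj₂ (proj₂ (proj₂ (proj₂ g))))))

corollary4 : (F : Formalism) (t : Theory.GTIR F) → Theory.IsGTIR F t →
    (∀ G → G ∈ Theory.components F t → Theory.Safe F (Theory.baseSys F G)) →
    Theory.Safe F (Theory.sem F t)
corollary4 F t isGTIR safe = proj₂ (CompositionSafety.gtir-safe F t isGTIR safe)
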